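{- Let $a,b,c,d$ be real numbers with $a+b=c+d$, let $n\ge 1$, and let $k_1,\dots,k_n$ be arbitrary real numbers. Define finite sequences $x^{(m)}=(x^{(m)}_1,\dots,x^{(m)}_{2^m})$ and $y^{(m)}=(y^{(m)}_1,\dots,y^{(m)}_{2^m})$ for $1\le m\le n$ recursively by $x^{(1)}=(a+k_1,\;b+k_1)$, $y^{(1)}=(c+k_1,\;d+k_1)$, and for $2\le m\le n$ and $1\le j\le 2^{m-1}$: $x^{(m)}_j=x^{(m-1)}_j$, $x^{(m)}_{2^{m-1}+j}=y^{(m-1)}_j+k_m$, $y^{(m)}_j=y^{(m-1)}_j$, $y^{(m)}_{2^{m-1}+j}=x^{(m-1)}_j+k_m$. Then $$\sum_{i=1}^{2^n}\bigl(x^{(n)}_i\bigr)^n=\sum_{i=1}^{2^n}\bigl(y^{(n)}_i\bigr)^n .$$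
   Context: All numbers are real. In words: the $x$-sequence at stage $m$ is the $x$-sequence of stage $m-1$ followed by the $y$-sequence of stage $m-1$ with $k_m$ added to each entry, and symmetrically for the $y$-sequence. -}

module Defs where

open import Level using (Level)
open import Algebra.Bundles using (CommutativeRing)
open import Data.Nat using (ℕ; zero; suc)
open import Data.List using (List; []; _∷_; _++_; map; foldr)
open import Data.Product using (_×_; _,_; proj₁; proj₂)

module Seq {c ℓ : Level} (R : CommutativeRing c ℓ) where
  open CommutativeRing R

  pow : Carrier → ℕ → Carrier
  pow x zero    = 1#
  pow x (suc n) = x * pow x n

  sumL : List Carrier → Carrier
  sumL = foldr _+_ 0#

  -- stages m ≥ 1 of the pair (x^(m), y^(m)); k m is k_m.
  -- Stage 0 is a dummy value that is never used (the theorem assumes n ≥ 1).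
  xy : (a b c d : Carrier) (k : ℕ → Carrier) → ℕ → List Carrier × List Carrier
  xy a b c d k zero = ([] , [])
  xy a b c d k (suc zero) =
    ((a + k 1) ∷ (b + k 1) ∷ []) , ((c + k 1) ∷ (d + k 1) ∷ [])
  xy a b c d k (suc (suc m)) =
    let p  = xy a b c d k (suc m)
        km = k (suc (suc m))
    in (proj₁ p ++ map (_+ km) (proj₂ p)) , (proj₂ p ++ map (_+ km) (proj₁ p))

{-# OPTIONS --safe #-}
module Submission where

-- Write Pⱼ(xs) for the j-th power sum. Shifting by k mixes degrees only
-- downwards: Pⱼ(xs + k) = Σᵣ C(j,r) k^(j-r) Pᵣ(xs). Hence if xs and ys have the
-- same power sums below degree j, then Pⱼ(xs) + Pⱼ(ys + k) = Pⱼ(ys) + Pⱼ(xs + k),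
-- i.e. Pⱼ(xs ++ (ys + k)) = Pⱼ(ys ++ (xs + k)). So each stage of the construction
-- keeps the agreement of the previous one and gains one more degree; stage 1
-- agrees in degrees 0 and 1 because a + b = c + d.
-- Instead of the binomial expansion we induct on q in the mixed sums
-- Σ x^p (x + k)^q, using (x + k)^(q+1) = x (x + k)^q + k (x + k)^q: they agree
-- when p + q < j and are balanced as above when p + q = j.

open import Defs
open import Level using (Level)
open import Algebra.Bundles using (CommutativeRing)
open import Data.Nat using (ℕ; zero; suc; _≤_; _<_; s≤s) renaming (_+_ to _+ℕ_)
open import Data.Nat.Properties using (+-suc; ≤-refl; ≤-trans; <-trans; n<1+n; ≤-pred)
import Data.Nat.Properties as ℕ
open import Data.List using (List; []; _∷_; _++_; map)
open import Data.List.Properties using (map-++)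
open import Data.Product using (proj₁; proj₂)
import Algebra.Properties.CommutativeSemigroup as CommSemigroupProperties
import Relation.Binary.PropositionalEquality as ≡
import Relation.Binary.Reasoning.Setoid as SetoidReasoning

module _ {c ℓ : Level} (R : CommutativeRing c ℓ) where
  open CommutativeRing R
  open Seq R
  open CommSemigroupProperties +-commutativeSemigroup using (interchange; xy∙z≈xz∙y)
  open CommSemigroupProperties *-commutativeSemigroup using (x∙yz≈yx∙z; x∙yz≈y∙xz)
  open SetoidReasoning setoid

  sumL-++ : ∀ xs ys → sumL (xs ++ ys) ≈ sumL xs + sumL ys
  sumL-++ []       ys = sym (+-identityˡ _)
  sumL-++ (x ∷ xs) ys = trans (+-congˡ (sumL-++ xs ys)) (sym (+-assoc _ _ _))

  sumL-map-cong : ∀ {f g : Carrier → Carrier} → (∀ x → f x ≈ g x) →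
                  ∀ xs → sumL (map f xs) ≈ sumL (map g xs)
  sumL-map-cong f≈g []       = refl
  sumL-map-cong f≈g (x ∷ xs) = +-cong (f≈g x) (sumL-map-cong f≈g xs)

  sumL-map-+ : ∀ (f g : Carrier → Carrier) xs →
               sumL (map (λ x → f x + g x) xs) ≈ sumL (map f xs) + sumL (map g xs)
  sumL-map-+ f g []       = sym (+-identityˡ 0#)
  sumL-map-+ f g (x ∷ xs) = trans (+-congˡ (sumL-map-+ f g xs)) (interchange _ _ _ _)

  sumL-map-*ˡ : ∀ k (f : Carrier → Carrier) xs →
                sumL (map (λ x → k * f x) xs) ≈ k * sumL (map f xs)
  sumL-map-*ˡ k f []       = sym (zeroʳ k)
  sumL-map-*ˡ k f (x ∷ xs) =
    trans (+-congˡ (sumL-map-*ˡ k f xs)) (sym (distribˡ k (f x) _))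

  powerSum : ℕ → List Carrier → Carrier
  powerSum j xs = sumL (map (λ x → pow x j) xs)

  PowerSumsAgreeBelow : ℕ → List Carrier → List Carrier → Set ℓ
  PowerSumsAgreeBelow j xs ys = ∀ r → r < j → powerSum r xs ≈ powerSum r ys

  powerSum-++ : ∀ j xs ys → powerSum j (xs ++ ys) ≈ powerSum j xs + powerSum j ys
  powerSum-++ j xs ys =
    trans (reflexive (≡.cong sumL (map-++ _ xs ys))) (sumL-++ (map _ xs) (map _ ys))

  mixedPowerSum : Carrier → ℕ → ℕ → List Carrier → Carrier
  mixedPowerSum k p q xs = sumL (map (λ x → pow x p * pow (x + k) q) xs)

  mixedPowerSum-zero : ∀ k p xs → mixedPowerSum k p 0 xs ≈ powerSum p xs
  mixedPowerSum-zero k p = sumL-map-cong (λ x → *-identityʳ (pow x p))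

  mixedPowerSum-shift : ∀ k j xs → mixedPowerSum k 0 j xs ≈ powerSum j (map (_+ k) xs)
  mixedPowerSum-shift k j []       = refl
  mixedPowerSum-shift k j (x ∷ xs) = +-cong (*-identityˡ _) (mixedPowerSum-shift k j xs)

  mixedPowerSum-suc : ∀ k p q xs →
    mixedPowerSum k p (suc q) xs ≈ mixedPowerSum k (suc p) q xs + k * mixedPowerSum k p q xs
  mixedPowerSum-suc k p q xs = begin
    mixedPowerSum k p (suc q) xs
      ≈⟨ sumL-map-cong expand xs ⟩
    sumL (map (λ x → pow x (suc p) * pow (x + k) q + k * (pow x p * pow (x + k) q)) xs)
      ≈⟨ sumL-map-+ _ _ xs ⟩
    mixedPowerSum k (suc p) q xs + sumL (map (λ x → k * (pow x p * pow (x + k) q)) xs)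
      ≈⟨ +-congˡ (sumL-map-*ˡ k _ xs) ⟩
    mixedPowerSum k (suc p) q xs + k * mixedPowerSum k p q xs ∎
    where
    expand : ∀ x → pow x p * ((x + k) * pow (x + k) q)
                 ≈ pow x (suc p) * pow (x + k) q + k * (pow x p * pow (x + k) q)
    expand x = trans (*-congˡ (distribʳ _ x k))
                 (trans (distribˡ _ _ _) (+-cong (x∙yz≈yx∙z _ x _) (x∙yz≈y∙xz _ k _)))

  mixedPowerSum-agree : ∀ {j} k p q xs ys → PowerSumsAgreeBelow j xs ys → p +ℕ q < j →
    mixedPowerSum k p q xs ≈ mixedPowerSum k p q ys
  mixedPowerSum-agree k p zero xs ys agree p<j rewrite ℕ.+-identityʳ p = begin
    mixedPowerSum k p 0 xs  ≈⟨ mixedPowerSum-zero k p xs ⟩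
    powerSum p xs           ≈⟨ agree p p<j ⟩
    powerSum p ys           ≈⟨ mixedPowerSum-zero k p ys ⟨
    mixedPowerSum k p 0 ys  ∎
  mixedPowerSum-agree k p (suc q) xs ys agree p+q<j rewrite +-suc p q = begin
    mixedPowerSum k p (suc q) xs
      ≈⟨ mixedPowerSum-suc k p q xs ⟩
    mixedPowerSum k (suc p) q xs + k * mixedPowerSum k p q xs
      ≈⟨ +-cong (mixedPowerSum-agree k (suc p) q xs ys agree p+q<j)
                (*-congˡ (mixedPowerSum-agree k p q xs ys agree (<-trans (n<1+n _) p+q<j))) ⟩
    mixedPowerSum k (suc p) q ys + k * mixedPowerSum k p q ys
      ≈⟨ mixedPowerSum-suc k p q ys ⟨
    mixedPowerSum k p (suc q) ys ∎

  mixedPowerSum-balance : ∀ k p q xs ys → PowerSumsAgreeBelow (p +ℕ q) xs ys →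
    mixedPowerSum k p q xs + powerSum (p +ℕ q) ys ≈ mixedPowerSum k p q ys + powerSum (p +ℕ q) xs
  mixedPowerSum-balance k p zero xs ys _ rewrite ℕ.+-identityʳ p = begin
    mixedPowerSum k p 0 xs + powerSum p ys  ≈⟨ +-congʳ (mixedPowerSum-zero k p xs) ⟩
    powerSum p xs + powerSum p ys           ≈⟨ +-comm _ _ ⟩
    powerSum p ys + powerSum p xs           ≈⟨ +-congʳ (mixedPowerSum-zero k p ys) ⟨
    mixedPowerSum k p 0 ys + powerSum p xs  ∎
  mixedPowerSum-balance k p (suc q) xs ys agree rewrite +-suc p q = begin
    mixedPowerSum k p (suc q) xs + powerSum (suc p +ℕ q) ys
      ≈⟨ +-congʳ (mixedPowerSum-suc k p q xs) ⟩
    (mixedPowerSum k (suc p) q xs + k * mixedPowerSum k p q xs) + powerSum (suc p +ℕ q) ys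
      ≈⟨ xy∙z≈xz∙y _ _ _ ⟩
    (mixedPowerSum k (suc p) q xs + powerSum (suc p +ℕ q) ys) + k * mixedPowerSum k p q xs
      ≈⟨ +-cong (mixedPowerSum-balance k (suc p) q xs ys agree)
                (*-congˡ (mixedPowerSum-agree k p q xs ys agree ≤-refl)) ⟩
    (mixedPowerSum k (suc p) q ys + powerSum (suc p +ℕ q) xs) + k * mixedPowerSum k p q ys
      ≈⟨ xy∙z≈xz∙y _ _ _ ⟨
    (mixedPowerSum k (suc p) q ys + k * mixedPowerSum k p q ys) + powerSum (suc p +ℕ q) xs
      ≈⟨ +-congʳ (mixedPowerSum-suc k p q ys) ⟨
    mixedPowerSum k p (suc q) ys + powerSum (suc p +ℕ q) xs ∎

  powerSum-++-shift-swap : ∀ k j xs ys → PowerSumsAgreeBelow j xs ys →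
    powerSum j (xs ++ map (_+ k) ys) ≈ powerSum j (ys ++ map (_+ k) xs)
  powerSum-++-shift-swap k j xs ys agree = begin
    powerSum j (xs ++ map (_+ k) ys)          ≈⟨ powerSum-++ j xs _ ⟩
    powerSum j xs + powerSum j (map (_+ k) ys) ≈⟨ +-comm _ _ ⟩
    powerSum j (map (_+ k) ys) + powerSum j xs ≈⟨ +-congʳ (mixedPowerSum-shift k j ys) ⟨
    mixedPowerSum k 0 j ys + powerSum j xs     ≈⟨ mixedPowerSum-balance k 0 j xs ys agree ⟨
    mixedPowerSum k 0 j xs + powerSum j ys     ≈⟨ +-congʳ (mixedPowerSum-shift k j xs) ⟩
    powerSum j (map (_+ k) xs) + powerSum j ys ≈⟨ +-comm _ _ ⟩
    powerSum j ys + powerSum j (map (_+ k) xs) ≈⟨ powerSum-++ j ys _ ⟨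
    powerSum j (ys ++ map (_+ k) xs)          ∎

  powerSum-one-pair : ∀ u v → powerSum 1 (u ∷ v ∷ []) ≈ u + v
  powerSum-one-pair u v = +-cong (*-identityʳ u) (trans (+-identityʳ _) (*-identityʳ v))

  module _ (a b c d : Carrier) (a+b≈c+d : a + b ≈ c + d) (k : ℕ → Carrier) where

    xy-powerSumsAgreeBelow : ∀ m →
      PowerSumsAgreeBelow (suc m) (proj₁ (xy a b c d k m)) (proj₂ (xy a b c d k m))
    xy-powerSumsAgreeBelow zero          zero          _ = refl
    xy-powerSumsAgreeBelow zero          (suc r)       (s≤s ())
    xy-powerSumsAgreeBelow (suc zero)    zero          _ = refl
    xy-powerSumsAgreeBelow (suc zero)    (suc zero)    _ = begin
      powerSum 1 ((a + k 1) ∷ (b + k 1) ∷ [])  ≈⟨ powerSum-one-pair _ _ ⟩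
      (a + k 1) + (b + k 1)                    ≈⟨ interchange a (k 1) b (k 1) ⟩
      (a + b) + (k 1 + k 1)                    ≈⟨ +-congʳ a+b≈c+d ⟩
      (c + d) + (k 1 + k 1)                    ≈⟨ interchange c (k 1) d (k 1) ⟨
      (c + k 1) + (d + k 1)                    ≈⟨ powerSum-one-pair _ _ ⟨
      powerSum 1 ((c + k 1) ∷ (d + k 1) ∷ [])  ∎
    xy-powerSumsAgreeBelow (suc zero)    (suc (suc r)) (s≤s (s≤s ()))
    xy-powerSumsAgreeBelow (suc (suc m)) r             r<m+3 =
      powerSum-++-shift-swap (k (suc (suc m))) r
        (proj₁ (xy a b c d k (suc m))) (proj₂ (xy a b c d k (suc m)))
        (λ r′ r′<r → xy-powerSumsAgreeBelow (suc m) r′ (≤-trans r′<r (≤-pred r<m+3)))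

-- The dummy stage xy … 0 = ([] , []) satisfies the claim too, so 1 ≤ n is not needed.
theorem1 : {c ℓ : Level} (R : CommutativeRing c ℓ) →
    let open CommutativeRing R
        open Seq R
    in (a b c d : Carrier) → a + b ≈ c + d →
       (n : ℕ) → 1 ≤ n → (k : ℕ → Carrier) →
       sumL (map (λ x → pow x n) (proj₁ (xy a b c d k n)))
         ≈ sumL (map (λ y → pow y n) (proj₂ (xy a b c d k n)))
theorem1 R a b c d a+b≈c+d n _ k = xy-powerSumsAgreeBelow R a b c d a+b≈c+d k n n ≤-refl
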